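{- Let $k\ge1$ and $m\ge0$, and consider the $k$ consecutive appends taking the U-MMB from $m$ leaves to $m+k$ leaves. Among these appends there is at most one merge step in which the merging mountains have height at least $\lceil\log_2 k\rceil$. Consequently, any leaf participates in at most $\lceil\log_2 k\rceil+1$ merge steps during these appends, and each of the $k$ new leaves $h_{m+1},\dots,h_{m+k}$ ends (in the structure with $m+k$ leaves) in a mountain of height at most $\lceil\log_2 k\rceil+1$.
   Context: A mountain of height $s\ge0$ is a perfect binary tree with $2^s$ leaves; its root is its peak. The U-MMB with $n$ leaves is an ordered (left-to-right) list of mountains whose leaves read left to right are $h_1,\dots,h_n$, defined inductively from the empty list: the $n$-th append (1) adds $h_n$ as a height-0 mountain at the right end, and (2) if there exist two consecutive mountains of equal height, takes the rightmost such pair, of height $s$, and replaces it in place by a mountain of height $s+1$ whose new peak has the two old peaks as children (a merge step, in which the merging mountains have height $s$). A leaf participates in a merge step if it belongs to one of the two merged mountains. -}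

module Defs where

open import Data.Nat using (ℕ; zero; suc; _+_; _≟_)
open import Data.List using (List; []; _∷_; _++_; length; filter; applyUpTo)
open import Data.List.Membership.DecPropositional _≟_ using (_∈?_)
open import Data.Product using (Σ; _,_; _×_)
open import Data.Maybe using (Maybe; just; nothing)
open import Relation.Binary.PropositionalEquality using (_≡_; refl)
open import Relation.Nullary using (yes; no)

-- A mountain of height s: a perfect binary tree with 2^s leaves.
-- Leaves are labelled by their index i (the leaf h_i); the values h_i
-- play no role in the shape of the structure.
data Mountain : ℕ → Set where
  leaf : ℕ → Mountain 0
  node : ∀ {s} → Mountain s → Mountain s → Mountain (suc s)

leaves : ∀ {s} → Mountain s → List ℕ
leaves (leaf i)   = i ∷ []
leaves (node l r) = leaves l ++ leaves r

Mtn : Set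
Mtn = Σ ℕ Mountain

Merge : Set
Merge = Σ ℕ (λ s → Mountain s × Mountain s)

mergeRightmost : List Mtn → Maybe (List Mtn × Merge)
mergeRightmost [] = nothing
mergeRightmost (x ∷ xs) with mergeRightmost xs
... | just (ys , mg) = just (x ∷ ys , mg)
mergeRightmost ((s , t) ∷ []) | nothing = nothing
mergeRightmost ((s , t) ∷ (s' , t') ∷ xs) | nothing with s ≟ s'
... | yes refl = just ((suc s , node t t') ∷ xs , (s , t , t'))
... | no _     = nothing

appendStep : ℕ → List Mtn → List Mtn × Maybe Merge
appendStep n xs with mergeRightmost (xs ++ (0 , leaf n) ∷ [])
... | just (ys , mg) = ys , just mg
... | nothing        = xs ++ (0 , leaf n) ∷ [] , nothing

umb : ℕ → List Mtn
umb zero    = []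
umb (suc n) = Data.Product.proj₁ (appendStep (suc n) (umb n))

mergeAt : ℕ → Maybe Merge
mergeAt zero    = nothing
mergeAt (suc n) = Data.Product.proj₂ (appendStep (suc n) (umb n))

participants : ℕ → List ℕ
participants n with mergeAt n
... | just (s , l , r) = leaves l ++ leaves r
... | nothing          = []

appendsFrom : ℕ → ℕ → List ℕ
appendsFrom m k = applyUpTo (λ t → suc (m + t)) k

participationCount : ℕ → ℕ → ℕ → ℕ
participationCount m k ℓ = length (filter (λ i → ℓ ∈? participants i) (appendsFrom m k))

{-# OPTIONS --safe #-}
-- The U-MMB is a binary counter: the mountain with q mountains to its right has
-- height q or q + 1, and these excess digits, read in binary, form a counter that
-- each append either increments, by a merge at some height s after which the
-- counter is divisible by 2^s, or resets to 0, when nothing merges. Hence two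
-- merges at heights ≥ L are at least 2^L appends apart, and k ≤ 2^⌈log₂ k⌉ appends
-- contain at most one merge at height ≥ ⌈log₂ k⌉. The mountain of a leaf grows by
-- exactly one in each merge the leaf takes part in, so ⌈log₂ k⌉ + 2 such merges
-- would include two distinct ones at heights ≥ ⌈log₂ k⌉; and a new leaf starts at
-- height 0.
module Submission where

open import Defs
open import Data.Empty using (⊥; ⊥-elim)
open import Data.List using (List; []; _∷_; _++_; [_]; length; filter; applyUpTo)
open import Data.List.Properties using (++-assoc; ++-identityʳ; applyUpTo-∷ʳ; filter-++; length-++)
open import Data.List.Membership.Propositional using (_∈_; _∉_)
open import Data.List.Membership.Propositional.Properties using (∈-++⁺ˡ; ∈-++⁺ʳ; ∈-++⁻; ∈-applyUpTo⁻)
open import Data.List.Relation.Unary.All as All using ()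
open import Data.List.Relation.Unary.AllPairs using (_∷_)
open import Data.List.Relation.Unary.Any using (here; there)
open import Data.List.Relation.Unary.Unique.Propositional using (Unique)
open import Data.List.Relation.Unary.Unique.Propositional.Properties using (applyUpTo⁺₁)
open import Data.Maybe using (Maybe; just; nothing)
open import Data.Nat
open import Data.Nat.Divisibility using (_∣_; _∣0; ∣-reflexive; ∣-trans; ∣⇒≤; ∣m∣n⇒∣m+n; ∣m+n∣m⇒∣n; m∣m*n)
open import Data.Nat.Logarithm using (⌈log₂_⌉)
open import Data.Nat.Logarithm.Core using (⌈log2⌉)
open import Data.Nat.Properties
open import Data.List.Membership.DecPropositional _≟_ using (_∈?_)
open import Data.Product using (∃; ∃₂; _×_; _,_; -,_; proj₁; proj₂)
open import Data.Sum using (_⊎_; inj₁; inj₂)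
open import Function using (_∘_)
open import Induction.WellFounded using (Acc; acc)
open import Relation.Binary.Definitions using (tri<; tri≈; tri>)
open import Relation.Binary.PropositionalEquality hiding ([_])
open import Relation.Nullary using (¬_; Dec; yes; no)

variable
  ℓ n p s s′ : ℕ
  xs ys w : List Mtn

^-monoʳ-∣ : ∀ m {i j} → i ≤ j → m ^ i ∣ m ^ j
^-monoʳ-∣ m {i} i≤j with o , refl ← m≤n⇒∃[o]m+o≡n i≤j =
  subst (m ^ i ∣_) (sym (^-distribˡ-+-* m i o)) (m∣m*n (m ^ o))

n≤2^⌈log2⌉n : ∀ n (a : Acc _<_ n) → n ≤ 2 ^ ⌈log2⌉ n a
n≤2^⌈log2⌉n 0             _        = z≤n
n≤2^⌈log2⌉n 1             _        = s≤s z≤n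
n≤2^⌈log2⌉n (suc (suc n)) (acc rs) = begin
  2 + n                 ≤⟨ +-monoʳ-≤ 2 n≤2*⌈n/2⌉ ⟩
  2 + 2 * ⌈ n /2⌉       ≡⟨ *-suc 2 ⌈ n /2⌉ ⟨
  2 * suc ⌈ n /2⌉       ≤⟨ *-monoʳ-≤ 2 (n≤2^⌈log2⌉n (suc ⌈ n /2⌉) _) ⟩
  2 ^ ⌈log2⌉ (2 + n) (acc rs) ∎
  where
  open ≤-Reasoning
  n≤2*⌈n/2⌉ : n ≤ 2 * ⌈ n /2⌉
  n≤2*⌈n/2⌉ = begin
    n                     ≡⟨ ⌊n/2⌋+⌈n/2⌉≡n n ⟨
    ⌊ n /2⌋ + ⌈ n /2⌉     ≤⟨ +-monoˡ-≤ ⌈ n /2⌉ (⌊n/2⌋≤⌈n/2⌉ n) ⟩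
    ⌈ n /2⌉ + ⌈ n /2⌉     ≡⟨ cong (⌈ n /2⌉ +_) (+-identityʳ ⌈ n /2⌉) ⟨
    2 * ⌈ n /2⌉           ∎

n≤2^⌈log₂n⌉ : ∀ n → n ≤ 2 ^ ⌈log₂ n ⌉
n≤2^⌈log₂n⌉ n = n≤2^⌈log2⌉n n _

unique-++⁻ʳ : ∀ {A : Set} (xs : List A) {ys} → Unique (xs ++ ys) → Unique ys
unique-++⁻ʳ []       u       = u
unique-++⁻ʳ (_ ∷ xs) (_ ∷ u) = unique-++⁻ʳ xs u

unique-++⇒∉ : ∀ {A : Set} (xs : List A) {ys x} → Unique (xs ++ ys) → x ∈ ys → x ∉ xs
unique-++⇒∉ (_ ∷ xs) (x≢ ∷ _) x∈ys (here refl)  = All.lookup x≢ (∈-++⁺ʳ xs x∈ys) refl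
unique-++⇒∉ (_ ∷ xs) (_ ∷ u)  x∈ys (there x∈xs) = unique-++⇒∉ xs u x∈ys x∈xs

data Digit (p : ℕ) : ℕ → Set where
  0# : Digit p p
  1# : Digit p (suc p)

digitValue : Digit p s → ℕ
digitValue     0# = 0
digitValue {p} 1# = 2 ^ p

-- Binary p xs: xs has p mountains, and the one with q mountains to its right
-- has height q + d for a binary digit d.
data Binary : ℕ → List Mtn → Set where
  []  : Binary 0 []
  _∷_ : {t : Mountain s} → Digit p s → Binary p xs → Binary (suc p) ((s , t) ∷ xs)

value : Binary p xs → ℕ
value []      = 0
value (d ∷ c) = digitValue d + value c

2^∣digitValue : (d : Digit p s) → n ≤ p → 2 ^ n ∣ digitValue d
2^∣digitValue 0# _   = _ ∣0
2^∣digitValue 1# n≤p = ^-monoʳ-∣ 2 n≤p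

mergeRightmost-∷ : ∀ x w {mg} → mergeRightmost w ≡ just (ys , mg) →
                   mergeRightmost (x ∷ w) ≡ just (x ∷ ys , mg)
mergeRightmost-∷ x w e rewrite e = refl

mergeRightmost-equal : (t t′ : Mountain s) (xs : List Mtn) → mergeRightmost ((s , t′) ∷ xs) ≡ nothing →
  mergeRightmost ((s , t) ∷ (s , t′) ∷ xs) ≡ just ((suc s , node t t′) ∷ xs , s , t , t′)
mergeRightmost-equal {s} t t′ xs e rewrite e with s ≟ s
... | yes refl = refl
... | no s≢s   = ⊥-elim (s≢s refl)

mergeRightmost-unequal : (t : Mountain s) (t′ : Mountain s′) (xs : List Mtn) → s ≢ s′ →
  mergeRightmost ((s′ , t′) ∷ xs) ≡ nothing → mergeRightmost ((s , t) ∷ (s′ , t′) ∷ xs) ≡ nothing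
mergeRightmost-unequal {s} {s′} t t′ xs s≢s′ e rewrite e with s ≟ s′
... | yes s≡s′ = ⊥-elim (s≢s′ s≡s′)
... | no _     = refl

data Increment (c : Binary p xs) (w : List Mtn) : Set where
  overflow : mergeRightmost w ≡ nothing → (c′ : Binary (suc p) w) → value c′ ≡ 0 →
             suc (value c) ≡ 2 ^ p → Increment c w
  carry    : ∀ {ys s} {l r : Mountain s} → mergeRightmost w ≡ just (ys , s , l , r) →
             (c′ : Binary p ys) → value c′ ≡ suc (value c) → 2 ^ s ∣ value c′ → s < p →
             Increment c w

carry-into : {t : Mountain s} {c : Binary p xs} (d : Digit p s) → mergeRightmost w ≡ nothing →
             (c′ : Binary (suc p) w) → value c′ ≡ 0 → suc (value c) ≡ 2 ^ p →
             Increment (_∷_ {t = t} d c) ((s , t) ∷ w)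
carry-into {p = p} _ _ (1# ∷ _) v _ =
  ⊥-elim (≢-nonZero⁻¹ (2 ^ p) {{m^n≢0 2 p}} (m+n≡0⇒m≡0 (2 ^ p) v))
carry-into {p = p} {t = t} {c = c} 0# e (_∷_ {xs = xs} {t = t′} 0# c′) v all-ones =
  carry (mergeRightmost-equal t t′ xs e) (1# ∷ c′) value≡ (∣-reflexive (sym (trans value≡ all-ones))) ≤-refl
  where
  value≡ : 2 ^ p + value c′ ≡ suc (value c)
  value≡ = trans (cong (2 ^ p +_) v) (trans (+-identityʳ _) (sym all-ones))
carry-into {p = p} {t = t} {c = c} 1# e c′@(_∷_ {xs = xs} {t = t′} 0# _) v all-ones =
  overflow (mergeRightmost-unequal t t′ xs 1+n≢n e) (0# ∷ c′) v
    (trans (sym (+-suc (2 ^ p) (value c))) (cong (2 ^ p +_) (trans all-ones (sym (+-identityʳ _)))))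

increment : (c : Binary p xs) (z : Mountain 0) → Increment c (xs ++ [ 0 , z ])
increment []      z = overflow refl (0# ∷ []) refl refl
increment {xs = (_ ∷ xs)} (d ∷ c) z with increment c z
... | overflow e c′ v all-ones = carry-into d e c′ v all-ones
... | carry e c′ v 2^s∣ s<p    =
  carry (mergeRightmost-∷ _ (xs ++ [ 0 , z ]) e) (d ∷ c′) (trans (cong (digitValue d +_) v) (+-suc _ _))
        (∣m∣n⇒∣m+n (2^∣digitValue d (<⇒≤ s<p)) 2^s∣) (m<n⇒m<1+n s<p)

appendStep-nothing : mergeRightmost (xs ++ [ 0 , leaf n ]) ≡ nothing →
                     appendStep n xs ≡ (xs ++ [ 0 , leaf n ] , nothing)
appendStep-nothing e rewrite e = refl

appendStep-just : ∀ {mg} → mergeRightmost (xs ++ [ 0 , leaf n ]) ≡ just (ys , mg) →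
                  appendStep n xs ≡ (ys , just mg)
appendStep-just e rewrite e = refl

record CounterStep (c : Binary p xs) (step : List Mtn × Maybe Merge) : Set where
  field
    {width} : ℕ
    binary  : Binary width (proj₁ step)
    reset   : proj₂ step ≡ nothing → value binary ≡ 0
    advance : {l r : Mountain s} → proj₂ step ≡ just (s , l , r) →
              value binary ≡ suc (value c) × 2 ^ s ∣ value binary

counterStep : ∀ n (c : Binary p xs) → CounterStep c (appendStep n xs)
counterStep n c with increment c (leaf n)
... | overflow e c′ v _ rewrite e =
  record { binary = c′ ; reset = λ _ → v ; advance = λ () }
... | carry e c′ v 2^s∣ _ rewrite e =
  record { binary = c′ ; reset = λ () ; advance = λ { refl → v , 2^s∣ } }

umbBinary : ∀ n → ∃ λ p → Binary p (umb n)
umbBinary zero    = -, []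
umbBinary (suc n) = -, CounterStep.binary (counterStep (suc n) (proj₂ (umbBinary n)))

counter : ℕ → ℕ
counter n = value (proj₂ (umbBinary n))

counter-reset : ∀ n → mergeAt (suc n) ≡ nothing → counter (suc n) ≡ 0
counter-reset n = CounterStep.reset (counterStep (suc n) (proj₂ (umbBinary n)))

counter-advance : ∀ n {l r : Mountain s} → mergeAt (suc n) ≡ just (s , l , r) →
                  counter (suc n) ≡ suc (counter n) × 2 ^ s ∣ counter (suc n)
counter-advance n = CounterStep.advance (counterStep (suc n) (proj₂ (umbBinary n)))

counter-drift : ∀ n d → counter (n + d) ≡ counter n + d ⊎ counter (n + d) < d
counter-drift n zero    = inj₁ (trans (cong counter (+-identityʳ n)) (sym (+-identityʳ _)))
counter-drift n (suc d) rewrite +-suc n d with mergeAt (suc (n + d)) in e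
... | nothing = inj₂ (subst (_< suc d) (sym (counter-reset (n + d) e)) z<s)
... | just _ with counter-advance (n + d) e | counter-drift n d
...   | next≡ , _ | inj₁ drift = inj₁ (trans next≡ (trans (cong suc drift) (sym (+-suc _ d))))
...   | next≡ , _ | inj₂ small = inj₂ (subst (_< suc d) (sym next≡) (s<s small))

MergesAt : ℕ → ℕ → Set
MergesAt i s = ∃ λ (lr : Mountain s × Mountain s) → mergeAt i ≡ just (s , lr)

MergesAt-functional : ∀ i → MergesAt i s → MergesAt i s′ → s ≡ s′
MergesAt-functional _ (_ , e) (_ , e′) with trans (sym e) e′
... | refl = refl

module _ {L : ℕ} where

  2^L∣counter : ∀ i → MergesAt i s → L ≤ s → 2 ^ L ∣ counter i
  2^L∣counter (suc n) (_ , e) L≤s = ∣-trans (^-monoʳ-∣ 2 L≤s) (proj₂ (counter-advance n e))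

  2^L≤counter : ∀ i → MergesAt i s → L ≤ s → 2 ^ L ≤ counter i
  2^L≤counter (suc n) M@(_ , e) L≤s with counter-advance n e
  ... | next≡ , _ = subst (2 ^ L ≤_) (sym next≡) (∣⇒≤ (subst (2 ^ L ∣_) next≡ (2^L∣counter (suc n) M L≤s)))

  -- The counter advances by one per append, so between two merges at
  -- heights ≥ L it either gains a multiple of 2^L or restarts from 0.
  high-merges-far-apart : ∀ i d → MergesAt i s → MergesAt (i + suc d) s′ → L ≤ s → L ≤ s′ →
                          2 ^ L ≤ suc d
  high-merges-far-apart i d M M′ L≤s L≤s′ with counter-drift i (suc d)
  ... | inj₁ drift = ∣⇒≤ (∣m+n∣m⇒∣n (subst (2 ^ L ∣_) drift (2^L∣counter (i + suc d) M′ L≤s′)) (2^L∣counter i M L≤s))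
  ... | inj₂ small = <⇒≤ (≤-<-trans (2^L≤counter (i + suc d) M′ L≤s′) small)

  no-two-high-merges : ∀ {k m i j} → k ≤ 2 ^ L → m < i → i < j → j ≤ m + k →
                       MergesAt i s → MergesAt j s′ → L ≤ s → L ≤ s′ → ⊥
  no-two-high-merges {s′ = s′} {k = k} {m} {i} k≤2^L m<i i<j j≤m+k M M′ L≤s L≤s′
    with o , refl ← m≤n⇒∃[o]m+o≡n i<j =
    <⇒≱ (<-≤-trans gap<k k≤2^L) (high-merges-far-apart i o M (subst (λ j → MergesAt j s′) (sym (+-suc i o)) M′) L≤s L≤s′)
    where
    open ≤-Reasoning
    gap<k : suc o < k
    gap<k = +-cancelˡ-≤ m _ _ (begin
      m + suc (suc o) ≡⟨ +-suc m (suc o) ⟩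
      suc m + suc o   ≤⟨ +-monoˡ-≤ (suc o) m<i ⟩
      i + suc o       ≡⟨ +-suc i o ⟩
      suc i + o       ≤⟨ j≤m+k ⟩
      m + k           ∎)

  at-most-one-high-merge : ∀ {k m i j} → k ≤ 2 ^ L → m < i → i ≤ m + k → m < j → j ≤ m + k →
                           MergesAt i s → MergesAt j s′ → L ≤ s → L ≤ s′ → i ≡ j
  at-most-one-high-merge {i = i} {j} k≤2^L m<i i≤m+k m<j j≤m+k M M′ L≤s L≤s′ with <-cmp i j
  ... | tri< i<j _ _ = ⊥-elim (no-two-high-merges k≤2^L m<i i<j j≤m+k M M′ L≤s L≤s′)
  ... | tri≈ _ i≡j _ = i≡j
  ... | tri> _ _ j<i = ⊥-elim (no-two-high-merges k≤2^L m<j j<i i≤m+k M′ M L≤s′ L≤s)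

allLeaves : List Mtn → List ℕ
allLeaves []             = []
allLeaves ((_ , t) ∷ xs) = leaves t ++ allLeaves xs

allLeaves-++ : ∀ xs ys → allLeaves (xs ++ ys) ≡ allLeaves xs ++ allLeaves ys
allLeaves-++ []             ys = refl
allLeaves-++ ((_ , t) ∷ xs) ys = trans (cong (leaves t ++_) (allLeaves-++ xs ys)) (sym (++-assoc (leaves t) _ _))

allLeaves-merge : ∀ pre post (l r : Mountain s) →
  allLeaves (pre ++ (suc s , node l r) ∷ post) ≡ allLeaves (pre ++ (s , l) ∷ (s , r) ∷ post)
allLeaves-merge []             post l r = ++-assoc (leaves l) (leaves r) (allLeaves post)
allLeaves-merge ((_ , t) ∷ pre) post l r = cong (leaves t ++_) (allLeaves-merge pre post l r)

∈-allLeaves : {t : Mountain s} → (s , t) ∈ xs → ℓ ∈ leaves t → ℓ ∈ allLeaves xs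
∈-allLeaves                       (here refl) ℓ∈t = ∈-++⁺ˡ ℓ∈t
∈-allLeaves {xs = (_ , t₀) ∷ _} (there st∈) ℓ∈t = ∈-++⁺ʳ (leaves t₀) (∈-allLeaves st∈ ℓ∈t)

mergeRightmost-split : {l r : Mountain s} → mergeRightmost w ≡ just (ys , s , l , r) →
  ∃₂ λ pre post → w ≡ pre ++ (s , l) ∷ (s , r) ∷ post × ys ≡ pre ++ (suc s , node l r) ∷ post
mergeRightmost-split {w = x ∷ w} e with mergeRightmost w in e₀
mergeRightmost-split {w = x ∷ w} refl | just _ with pre , post , refl , refl ← mergeRightmost-split {w = w} e₀ =
  x ∷ pre , post , refl , refl
mergeRightmost-split {w = (s₀ , _) ∷ (s₁ , _) ∷ w} e | nothing with s₀ ≟ s₁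
mergeRightmost-split {w = (s₀ , _) ∷ (s₀ , _) ∷ w} refl | nothing | yes refl = [] , w , refl , refl

data AppendView (n : ℕ) (xs : List Mtn) : Set where
  no-merge : appendStep n xs ≡ (xs ++ [ 0 , leaf n ] , nothing) → AppendView n xs
  merge    : ∀ pre post (l r : Mountain s) → xs ++ [ 0 , leaf n ] ≡ pre ++ (s , l) ∷ (s , r) ∷ post →
             appendStep n xs ≡ (pre ++ (suc s , node l r) ∷ post , just (s , l , r)) → AppendView n xs

appendView : ∀ n xs → AppendView n xs
appendView n xs with mergeRightmost (xs ++ [ 0 , leaf n ]) in e
... | nothing = no-merge (appendStep-nothing e)
... | just (_ , _ , l , r) with pre , post , split , refl ← mergeRightmost-split e =
  merge pre post l r split (appendStep-just e)

allLeaves-appendStep : ∀ n xs → allLeaves (proj₁ (appendStep n xs)) ≡ allLeaves xs ++ [ n ]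
allLeaves-appendStep n xs with appendView n xs
... | no-merge e = trans (cong (allLeaves ∘ proj₁) e) (allLeaves-++ xs _)
... | merge pre post l r split e = begin
  allLeaves (proj₁ (appendStep n xs))           ≡⟨ cong (allLeaves ∘ proj₁) e ⟩
  allLeaves (pre ++ (_ , node l r) ∷ post)      ≡⟨ allLeaves-merge pre post l r ⟩
  allLeaves (pre ++ (_ , l) ∷ (_ , r) ∷ post)   ≡⟨ cong allLeaves split ⟨
  allLeaves (xs ++ [ 0 , leaf n ])              ≡⟨ allLeaves-++ xs _ ⟩
  allLeaves xs ++ [ n ]                         ∎
  where open ≡-Reasoning

allLeaves-umb : ∀ n → allLeaves (umb n) ≡ applyUpTo suc n
allLeaves-umb zero    = refl
allLeaves-umb (suc n) = begin
  allLeaves (umb (suc n))       ≡⟨ allLeaves-appendStep (suc n) (umb n) ⟩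
  allLeaves (umb n) ++ [ suc n ] ≡⟨ cong (_++ [ suc n ]) (allLeaves-umb n) ⟩
  applyUpTo suc n ++ [ suc n ]  ≡⟨ applyUpTo-∷ʳ suc n ⟩
  applyUpTo suc (suc n)         ∎
  where open ≡-Reasoning

unique-applyUpTo-suc : ∀ n → Unique (applyUpTo suc n)
unique-applyUpTo-suc n = applyUpTo⁺₁ suc n (λ i<j _ → <⇒≢ (s<s i<j))

unique-umb : ∀ n → Unique (allLeaves (umb n))
unique-umb n = subst Unique (sym (allLeaves-umb n)) (unique-applyUpTo-suc n)

unique-umb-snoc : ∀ n → Unique (allLeaves (umb n ++ [ 0 , leaf (suc n) ]))
unique-umb-snoc n =
  subst Unique (trans (allLeaves-appendStep (suc n) (umb n)) (sym (allLeaves-++ (umb n) _))) (unique-umb (suc n))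

heightOf : ℕ → List Mtn → ℕ
heightOf ℓ []             = 0
heightOf ℓ ((s , t) ∷ xs) with ℓ ∈? leaves t
... | yes _ = s
... | no  _ = heightOf ℓ xs

heightOf-here : ∀ {ℓ s} (t : Mountain s) xs → ℓ ∈ leaves t → heightOf ℓ ((s , t) ∷ xs) ≡ s
heightOf-here {ℓ} t _ ℓ∈t with ℓ ∈? leaves t
... | yes _   = refl
... | no ℓ∉t = ⊥-elim (ℓ∉t ℓ∈t)

heightOf-there : ∀ {ℓ s} (t : Mountain s) xs → ℓ ∉ leaves t → heightOf ℓ ((s , t) ∷ xs) ≡ heightOf ℓ xs
heightOf-there {ℓ} t _ ℓ∉t with ℓ ∈? leaves t
... | yes ℓ∈t = ⊥-elim (ℓ∉t ℓ∈t)
... | no _    = refl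

heightOf-++-cong : ∀ pre → heightOf ℓ xs ≡ heightOf ℓ ys → heightOf ℓ (pre ++ xs) ≡ heightOf ℓ (pre ++ ys)
heightOf-++-cong                 []              eq = eq
heightOf-++-cong {ℓ = ℓ} ((_ , t) ∷ pre) eq with ℓ ∈? leaves t
... | yes _ = refl
... | no  _ = heightOf-++-cong pre eq

-- Absent leaves also get height 0, so a final height-0 mountain changes nothing.
heightOf-snoc : ∀ xs (z : Mountain 0) → heightOf ℓ (xs ++ [ 0 , z ]) ≡ heightOf ℓ xs
heightOf-snoc {ℓ = ℓ} xs z = trans (heightOf-++-cong xs last≡0) (cong (heightOf ℓ) (++-identityʳ xs))
  where
  last≡0 : heightOf ℓ [ 0 , z ] ≡ 0
  last≡0 with ℓ ∈? leaves z
  ... | yes _ = refl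
  ... | no  _ = refl

heightOf-∉ : ℓ ∉ allLeaves xs → heightOf ℓ xs ≡ 0
heightOf-∉ {xs = []}           _   = refl
heightOf-∉ {xs = (_ , t) ∷ xs} ℓ∉ = trans (heightOf-there t xs (ℓ∉ ∘ ∈-++⁺ˡ)) (heightOf-∉ {xs = xs} (ℓ∉ ∘ ∈-++⁺ʳ (leaves t)))

heightOf-∈ : ∀ {ℓ s xs} {t : Mountain s} → Unique (allLeaves xs) → (s , t) ∈ xs → ℓ ∈ leaves t → heightOf ℓ xs ≡ s
heightOf-∈ {xs = _ ∷ xs} {t} _ (here refl) ℓ∈t = heightOf-here t xs ℓ∈t
heightOf-∈ {xs = (_ , t₀) ∷ xs} u (there st∈) ℓ∈t = trans
  (heightOf-there t₀ xs (unique-++⇒∉ (leaves t₀) u (∈-allLeaves st∈ ℓ∈t)))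
  (heightOf-∈ (unique-++⁻ʳ (leaves t₀) u) st∈ ℓ∈t)

module _ (pre post : List Mtn) (l r : Mountain s) where

  heightOf-merged : Unique (allLeaves (pre ++ (s , l) ∷ (s , r) ∷ post)) → ℓ ∈ leaves l ++ leaves r →
    heightOf ℓ (pre ++ (s , l) ∷ (s , r) ∷ post) ≡ s × heightOf ℓ (pre ++ (suc s , node l r) ∷ post) ≡ suc s
  heightOf-merged u ℓ∈ = before , heightOf-∈ u′ (∈-++⁺ʳ pre (here refl)) ℓ∈
    where
    u′ = subst Unique (sym (allLeaves-merge pre post l r)) u
    before : heightOf _ (pre ++ (s , l) ∷ (s , r) ∷ post) ≡ s
    before with ∈-++⁻ (leaves l) ℓ∈
    ... | inj₁ ℓ∈l = heightOf-∈ u (∈-++⁺ʳ pre (here refl)) ℓ∈l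
    ... | inj₂ ℓ∈r = heightOf-∈ u (∈-++⁺ʳ pre (there (here refl))) ℓ∈r

  heightOf-unmerged : ℓ ∉ leaves l ++ leaves r →
    heightOf ℓ (pre ++ (suc s , node l r) ∷ post) ≡ heightOf ℓ (pre ++ (s , l) ∷ (s , r) ∷ post)
  heightOf-unmerged ℓ∉ = heightOf-++-cong pre (begin
    heightOf _ ((suc s , node l r) ∷ post) ≡⟨ heightOf-there (node l r) post ℓ∉ ⟩
    heightOf _ post                        ≡⟨ heightOf-there r post (ℓ∉ ∘ ∈-++⁺ʳ (leaves l)) ⟨
    heightOf _ ((s , r) ∷ post)            ≡⟨ heightOf-there l _ (ℓ∉ ∘ ∈-++⁺ˡ) ⟨
    heightOf _ ((s , l) ∷ (s , r) ∷ post)  ∎)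
    where open ≡-Reasoning

participants-merge : ∀ i {l r : Mountain s} → mergeAt i ≡ just (s , l , r) → participants i ≡ leaves l ++ leaves r
participants-merge i e rewrite e = refl

participants-no-merge : ∀ i → mergeAt i ≡ nothing → participants i ≡ []
participants-no-merge i e rewrite e = refl

data HeightStep (ℓ n : ℕ) : Set where
  raised : ℓ ∈ participants (suc n) → MergesAt (suc n) (heightOf ℓ (umb n)) →
           heightOf ℓ (umb (suc n)) ≡ suc (heightOf ℓ (umb n)) → HeightStep ℓ n
  kept   : ℓ ∉ participants (suc n) → heightOf ℓ (umb (suc n)) ≡ heightOf ℓ (umb n) → HeightStep ℓ n

heightStep : ∀ ℓ n → HeightStep ℓ n
heightStep ℓ n with appendView (suc n) (umb n)
... | no-merge e = kept ℓ∉ (trans (cong (heightOf ℓ ∘ proj₁) e) (heightOf-snoc (umb n) _))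
  where
  ℓ∉ : ℓ ∉ participants (suc n)
  ℓ∉ rewrite participants-no-merge (suc n) (cong proj₂ e) = λ ()
... | merge {s} pre post l r split e = step (ℓ ∈? leaves l ++ leaves r)
  where
  participants≡ : participants (suc n) ≡ leaves l ++ leaves r
  participants≡ = participants-merge (suc n) (cong proj₂ e)
  after≡ : heightOf ℓ (umb (suc n)) ≡ heightOf ℓ (pre ++ (suc s , node l r) ∷ post)
  after≡ = cong (heightOf ℓ ∘ proj₁) e
  before≡ : heightOf ℓ (umb n) ≡ heightOf ℓ (pre ++ (s , l) ∷ (s , r) ∷ post)
  before≡ = trans (sym (heightOf-snoc (umb n) _)) (cong (heightOf ℓ) split)
  step : Dec (ℓ ∈ leaves l ++ leaves r) → HeightStep ℓ n
  step (no ℓ∉)  = kept (subst (ℓ ∉_) (sym participants≡) ℓ∉)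
                       (trans after≡ (trans (heightOf-unmerged pre post l r ℓ∉) (sym before≡)))
  step (yes ℓ∈) with heightOf-merged pre post l r (subst Unique (cong allLeaves split) (unique-umb-snoc n)) ℓ∈
  ... | before , after =
    raised (subst (ℓ ∈_) (sym participants≡) ℓ∈)
           (subst (MergesAt (suc n)) (sym (trans before≡ before)) (-, cong proj₂ e))
           (trans after≡ (trans after (cong suc (sym (trans before≡ before)))))

participationAt : ℕ → ℕ → ℕ
participationAt ℓ i = length (filter (λ j → ℓ ∈? participants j) [ i ])

heightOf-umb-suc : ∀ ℓ n → heightOf ℓ (umb (suc n)) ≡ heightOf ℓ (umb n) + participationAt ℓ (suc n)
heightOf-umb-suc ℓ n with ℓ ∈? participants (suc n) | heightStep ℓ n
... | yes _  | raised _ _ h  = trans h (+-comm 1 _)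
... | no _   | kept _ h      = trans h (sym (+-identityʳ _))
... | yes ℓ∈ | kept ℓ∉ _     = ⊥-elim (ℓ∉ ℓ∈)
... | no ℓ∉  | raised ℓ∈ _ _ = ⊥-elim (ℓ∉ ℓ∈)

participationCount-suc : ∀ m d ℓ → participationCount m (suc d) ℓ ≡ participationCount m d ℓ + participationAt ℓ (suc (m + d))
participationCount-suc m d ℓ = begin
  length (filter P? (appendsFrom m (suc d)))                    ≡⟨ cong (length ∘ filter P?) (applyUpTo-∷ʳ _ d) ⟨
  length (filter P? (appendsFrom m d ++ [ suc (m + d) ]))        ≡⟨ cong length (filter-++ P? (appendsFrom m d) _) ⟩
  length (filter P? (appendsFrom m d) ++ filter P? [ suc (m + d) ]) ≡⟨ length-++ (filter P? (appendsFrom m d)) ⟩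
  participationCount m d ℓ + participationAt ℓ (suc (m + d))      ∎
  where
  open ≡-Reasoning
  P? : ∀ i → Dec (ℓ ∈ participants i)
  P? i = ℓ ∈? participants i

heightOf-window : ∀ ℓ m d → heightOf ℓ (umb (m + d)) ≡ heightOf ℓ (umb m) + participationCount m d ℓ
heightOf-window ℓ m zero    = trans (cong (heightOf ℓ ∘ umb) (+-identityʳ m)) (sym (+-identityʳ _))
heightOf-window ℓ m (suc d) = begin
  heightOf ℓ (umb (m + suc d))                                      ≡⟨ cong (heightOf ℓ ∘ umb) (+-suc m d) ⟩
  heightOf ℓ (umb (suc (m + d)))                                    ≡⟨ heightOf-umb-suc ℓ (m + d) ⟩
  heightOf ℓ (umb (m + d)) + participationAt ℓ (suc (m + d))         ≡⟨ cong (_+ participationAt ℓ (suc (m + d))) (heightOf-window ℓ m d) ⟩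
  h + participationCount m d ℓ + participationAt ℓ (suc (m + d))     ≡⟨ +-assoc h _ _ ⟩
  h + (participationCount m d ℓ + participationAt ℓ (suc (m + d)))   ≡⟨ cong (h +_) (participationCount-suc m d ℓ) ⟨
  h + participationCount m (suc d) ℓ                                ∎
  where
  open ≡-Reasoning
  h : ℕ
  h = heightOf ℓ (umb m)

height-crossing : ∀ ℓ m d {v} → heightOf ℓ (umb m) ≤ v → v < heightOf ℓ (umb (m + d)) →
                  ∃ λ i → m < i × i ≤ m + d × MergesAt i v
height-crossing ℓ m zero {v} h≤v v< =
  ⊥-elim (<⇒≱ (subst (λ k → v < heightOf ℓ (umb k)) (+-identityʳ m) v<) h≤v)
height-crossing ℓ m (suc d) {v} h≤v v< =
  step (heightStep ℓ (m + d)) (subst (λ k → v < heightOf ℓ (umb k)) (+-suc m d) v<)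
  where
  earlier : ∃ (λ i → m < i × i ≤ m + d × MergesAt i v) → ∃ λ i → m < i × i ≤ m + suc d × MergesAt i v
  earlier (i , m<i , i≤ , M) = i , m<i , ≤-trans i≤ (+-monoʳ-≤ m (n≤1+n d)) , M
  step : HeightStep ℓ (m + d) → v < heightOf ℓ (umb (suc (m + d))) → ∃ λ i → m < i × i ≤ m + suc d × MergesAt i v
  step (kept _ h)     v<′ = earlier (height-crossing ℓ m d h≤v (subst (v <_) h v<′))
  step (raised _ M h) v<′ with m≤n⇒m<n∨m≡n (≤-pred (subst (v <_) h v<′))
  ... | inj₁ v<h = earlier (height-crossing ℓ m d h≤v v<h)
  ... | inj₂ v≡h = suc (m + d) , s≤s (m≤m+n m d) , ≤-reflexive (sym (+-suc m d)) , subst (MergesAt (suc (m + d))) (sym v≡h) M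

participation-bound : ∀ {k L} m ℓ → k ≤ 2 ^ L → participationCount m k ℓ ≤ suc L
participation-bound {k} {L} m ℓ k≤2^L = ≮⇒≥ too-many
  where
  h : ℕ
  h = heightOf ℓ (umb m)
  below : suc L < participationCount m k ℓ → ∀ {x} → x ≤ suc L → h + x < heightOf ℓ (umb (m + k))
  below L+1<c x≤ = subst (h + _ <_) (sym (heightOf-window ℓ m k)) (+-monoʳ-< h (≤-<-trans x≤ L+1<c))
  -- Otherwise the height of ℓ would cross both h + L and h + L + 1, in two merges of height ≥ L.
  too-many : ¬ suc L < participationCount m k ℓ
  too-many L+1<c with height-crossing ℓ m k (m≤m+n h L) (below L+1<c (n≤1+n L))
                    | height-crossing ℓ m k (m≤m+n h (suc L)) (below L+1<c ≤-refl)
  ... | i , m<i , i≤ , M | j , m<j , j≤ , M′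
    with refl ← at-most-one-high-merge k≤2^L m<i i≤ m<j j≤ M M′ (m≤n+m L h) (≤-trans (n≤1+n L) (m≤n+m (suc L) h))
    = 1+n≢n (sym (+-cancelˡ-≡ h _ _ (MergesAt-functional i M M′)))

new-leaf-height : ∀ {k L} m {j s} {t : Mountain s} → k ≤ 2 ^ L → m < j →
                  (s , t) ∈ umb (m + k) → j ∈ leaves t → s ≤ suc L
new-leaf-height {k} {L} m {j} {s} k≤2^L m<j st∈ j∈t = begin
  s                                              ≡⟨ heightOf-∈ (unique-umb (m + k)) st∈ j∈t ⟨
  heightOf j (umb (m + k))                       ≡⟨ heightOf-window j m k ⟩
  heightOf j (umb m) + participationCount m k j  ≡⟨ cong (_+ participationCount m k j) (heightOf-∉ {xs = umb m} j∉) ⟩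
  participationCount m k j                       ≤⟨ participation-bound m j k≤2^L ⟩
  suc L                                          ∎
  where
  open ≤-Reasoning
  j∉ : j ∉ allLeaves (umb m)
  j∉ j∈ with i , i<m , refl ← ∈-applyUpTo⁻ suc (subst (j ∈_) (allLeaves-umb m) j∈) = <⇒≱ m<j i<m

lemma4 : (k m : ℕ) → 1 ≤ k →
    ((i j s s' : ℕ) (a b : Mountain s) (a' b' : Mountain s') →
       m < i → i ≤ m + k → m < j → j ≤ m + k →
       mergeAt i ≡ just (s , a , b) → mergeAt j ≡ just (s' , a' , b') →
       s ≥ ⌈log₂ k ⌉ → s' ≥ ⌈log₂ k ⌉ → i ≡ j)
    × ((ℓ : ℕ) → participationCount m k ℓ ≤ suc ⌈log₂ k ⌉)
    × ((j s : ℕ) (t : Mountain s) → m < j → j ≤ m + k →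
       (s , t) ∈ umb (m + k) → j ∈ leaves t → s ≤ suc ⌈log₂ k ⌉)
lemma4 k m _ =
    (λ i j s s′ a b a′ b′ m<i i≤ m<j j≤ e e′ →
       at-most-one-high-merge {i = i} {j} k≤2^L m<i i≤ m<j j≤ (-, e) (-, e′))
  , (λ ℓ → participation-bound m ℓ k≤2^L)
  , (λ j s t m<j _ → new-leaf-height m k≤2^L m<j)
  where
  k≤2^L : k ≤ 2 ^ ⌈log₂ k ⌉
  k≤2^L = n≤2^⌈log₂n⌉ k
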